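{- Let $r\geqslant 2$, $1\leqslant t\leqslant k-r$ and $n\geqslant k^4$ be integers. Then \[N_{r+1,t}(\mathcal{G}'_{r,t})=N_{r+1,t}(\mathcal{G}_{r,t})\geqslant\frac{999}{1000}\binom{r+t}{r+1}\binom{n-r-t}{k-r-t+1}^{r+1}.\]
   Context: $[n]=\{1,\dots,n\}$ and $\binom{[n]}{k}$ is the family of all $k$-element subsets of $[n]$. A family is $r$-wise $t$-intersecting if any $r$ of its members (not necessarily distinct) have at least $t$ common elements. A $(r+1,t)$-triangle is a family $\{T_1,\dots,T_{r+1}\}$ of $r+1$ sets which is $r$-wise $t$-intersecting and satisfies $|T_1\cap\cdots\cap T_{r+1}|\leqslant t-1$. For a family $\mathcal{F}$, $N_{r+1,t}(\mathcal{F})$ denotes the number of $(r+1)$-element subfamilies of $\mathcal{F}$ that are $(r+1,t)$-triangles. Define $\mathcal{G}_{r,t}=\{F\in\binom{[n]}{k}: |F\cap[r+t]|=r+t-1\}$ and $\mathcal{G}'_{r,t}=\{F\in\binom{[n]}{k}: |F\cap[r+t]|\geqslant r+t-1\}$. -}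

module Defs where

open import Data.Nat using (ℕ; zero; suc; _+_; _∸_; _≤_; _<_; _≟_; _≤?_; _<?_)
open import Data.Nat.Combinatorics using (_C_)
open import Data.Fin using (Fin; toℕ)
open import Data.Fin.Subset using (Subset; inside; outside; _∩_; ⋂; ∣_∣)
open import Data.Vec using ([]; _∷_; tabulate)
open import Data.List using (List; []; _∷_; [_]; map; _++_; filter; length; concatMap)
open import Data.List.Relation.Unary.All using (All; all?)
open import Data.Product using (_×_)
open import Relation.Nullary using (Dec; _×-dec_)
open import Relation.Nullary.Decidable using (yes; no; ⌊_⌋)
open import Relation.Unary using (Decidable)

allSubsets : (n : ℕ) → List (Subset n)
allSubsets zero = [ [] ]
allSubsets (suc n) = map (inside ∷_) (allSubsets n) ++ map (outside ∷_) (allSubsets n)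

kSubsets : (n k : ℕ) → List (Subset n)
kSubsets n k = filter (λ s → ∣ s ∣ ≟ k) (allSubsets n)

-- the subset [m] = {1,…,m} of [n]  (Fin n index i represents element i+1)
initSeg : (n m : ℕ) → Subset n
initSeg n m = tabulate (λ i → ⌊ toℕ i <? m ⌋)
  where
  open import Data.Bool using (Bool; true; false)

combinations : {A : Set} → ℕ → List A → List (List A)
combinations zero xs = [ [] ]
combinations (suc m) [] = []
combinations (suc m) (x ∷ xs) = map (x ∷_) (combinations m xs) ++ combinations (suc m) xs

tuples : {A : Set} → ℕ → List A → List (List A)
tuples zero xs = [ [] ]
tuples (suc m) xs = concatMap (λ x → map (x ∷_) (tuples m xs)) xs

-- a family (given as a list) is r-wise t-intersecting:
-- any r of its members (not necessarily distinct) share at least t elements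
RWiseTIntersecting : {n : ℕ} → ℕ → ℕ → List (Subset n) → Set
RWiseTIntersecting r t T = All (λ xs → t ≤ ∣ ⋂ xs ∣) (tuples r T)

IsTriangle : {n : ℕ} → ℕ → ℕ → List (Subset n) → Set
IsTriangle r t T = RWiseTIntersecting r t T × ∣ ⋂ T ∣ < t

isTriangle? : {n : ℕ} (r t : ℕ) → Decidable (IsTriangle {n} r t)
isTriangle? r t T = all? (λ xs → t ≤? ∣ ⋂ xs ∣) (tuples r T) ×-dec (∣ ⋂ T ∣ <? t)

-- N_{r+1,t}(F): number of (r+1)-element subfamilies of F that are (r+1,t)-triangles
-- (F is given as a duplicate-free list of sets)
N : {n : ℕ} → ℕ → ℕ → List (Subset n) → ℕ
N r t F = length (filter (isTriangle? r t) (combinations (suc r) F))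

G : (n k r t : ℕ) → List (Subset n)
G n k r t = filter (λ F → ∣ F ∩ initSeg n (r + t) ∣ ≟ (r + t) ∸ 1) (kSubsets n k)

G' : (n k r t : ℕ) → List (Subset n)
G' n k r t = filter (λ F → (r + t) ∸ 1 ≤? ∣ F ∩ initSeg n (r + t) ∣) (kSubsets n k)

{-# OPTIONS --safe #-}
-- Write c = r + t, m = n − c and s = k − c + 1.  Every set of G′ meets [c] in at least c − 1 points.
-- In an (r+1,t)-triangle of G′ no set can contain [c]: the other r sets miss at most r points of [c]
-- between them, so all r + 1 sets would share at least t points.  Hence G′ and G have the same triangles.
--
-- For the lower bound, choose r + 1 distinct points x₀ … x_r of [c] and r + 1 s-subsets O₀ … O_r of the
-- remaining m points with empty common intersection.  The sets ([c] ∖ {x_i}) ∪ O_i lie in G, any r of them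
-- share the t points of [c] that none of them misses, and all r + 1 share only the t − 1 points of [c] ∖ {x₀ … x_r};
-- distinct choices give distinct triangles.  A union bound over the point common to all O_i leaves at least
-- C(m,s)^(r+1) − m·C(m−1,s−1)^(r+1) admissible tuples, and since m·C(m−1,s−1) = s·C(m,s) while n ≥ k⁴
-- forces 1000·s^(r+1) ≤ m^r, this is at least 999/1000 · C(m,s)^(r+1).
module Submission where

open import Defs
open import Data.Nat using (ℕ; zero; suc; _+_; _*_; _∸_; _^_; _≤_; _<_; z≤n; s≤s; _<?_; _≟_; _≤?_; _⊓_; NonZero; >-nonZero)
open import Data.Nat.Combinatorics using (_C_; nCk+nC[k+1]≡[n+1]C[k+1])
open import Data.Nat.ListAction using (sum)
open import Data.Nat.Properties
open import Data.Nat.Tactic.RingSolver using (solve-∀)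
open import Data.Product using (_×_; _,_; proj₁; proj₂; Σ)
open import Data.Sum using (inj₁; inj₂)
open import Data.List using (List; []; _∷_; length; map; filter; _++_; concatMap; cartesianProduct; zipWith)
open import Data.List.Properties using (length-++; length-map; filter-++; filter-none; filter-all; filter-≐; ∷-injectiveˡ; ∷-injectiveʳ; length-zipWith)
open import Data.List.Membership.Propositional using (_∈_)
open import Data.List.Membership.Propositional.Properties using (∈-++⁻; ∈-map⁻; ∈-map⁺; ∈-++⁺ˡ; ∈-++⁺ʳ; ∈-∃++; ∈-filter⁻; ∈-filter⁺; ∈-cartesianProduct⁻)
open import Data.List.Relation.Unary.All as All using (All; []; _∷_; all?)
import Data.List.Relation.Unary.All.Properties as All
open import Data.List.Relation.Unary.AllPairs as AllPairs using (AllPairs; []; _∷_)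
open import Data.List.Relation.Unary.Any using (here; there)
open import Data.List.Relation.Unary.Unique.Propositional using (Unique)
import Data.List.Relation.Unary.Unique.Propositional.Properties as Unique
open import Data.List.Relation.Binary.Sublist.Propositional using (_⊆_; []; _∷_; _∷ʳ_; minimum)
open import Data.List.Relation.Binary.Sublist.Propositional.Properties using (Any-resp-⊆; All-resp-⊆)
import Data.List.Relation.Binary.Sublist.Propositional.Properties as Sublist
open import Data.Bool using (true; false; _∧_)
open import Data.Empty using (⊥-elim)
open import Data.Fin using (Fin; zero; suc; toℕ)
import Data.Fin as Fin
import Data.Fin.Properties as Fin
open import Data.Fin.Subset using (Subset; inside; outside; _∩_; ⋂; ∣_∣; ⊤; ⊥; Nonempty; _-_) renaming (_∈_ to _∈ₛ_)
open import Data.Fin.Subset.Properties using (_∈?_; ∈⊤; ∣⊤∣≡n; x∈p∩q⁺; drop-there; x∈p⇒∣p-x∣<∣p∣; x∈p∩q⁻; nonempty?; Empty-unique; ∣⊥∣≡0; ∣p∩q∣≤∣p∣; ∣p∩q∣≤∣q∣; ∩-identityˡ; ∩-identityʳ; ∩-zeroʳ)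
open import Data.Vec using ([]; _∷_; here; there) renaming (_++_ to _++ᵥ_)
open import Data.Vec.Properties using (tabulate-cong; ++-injectiveˡ; ++-injectiveʳ) renaming (∷-injectiveʳ to ∷-injectiveʳᵥ)
open import Function using (_∘_; id)
open import Level using (0ℓ)
open import Relation.Binary.PropositionalEquality
open import Relation.Nullary using (yes; no; ¬_; does; contradiction)
open import Relation.Nullary.Decidable using (isYes≗does)
open import Relation.Unary using (Pred; Decidable; _∪_)
open import Relation.Unary.Properties using (_∪?_)

private
  variable
    A B : Set

-- Binomial coefficients

-- Pascal's rule as the definition; `_C_` is defined through factorials and is only reached at the very end.
_choose_ : ℕ → ℕ → ℕ
n     choose zero  = 1
zero  choose suc k = 0
suc n choose suc k = n choose k + n choose suc k

choose≡C : ∀ n k → n choose k ≡ n C k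
choose≡C n       zero    = refl
choose≡C zero    (suc k) = refl
choose≡C (suc n) (suc k) =
  trans (cong₂ _+_ (choose≡C n k) (choose≡C n (suc k))) (nCk+nC[k+1]≡[n+1]C[k+1] n k)

n-choose-1 : ∀ n → n choose 1 ≡ n
n-choose-1 zero    = refl
n-choose-1 (suc n) = cong suc (n-choose-1 n)

suc-*-choose : ∀ n k → suc n * (n choose k) ≡ suc k * (suc n choose suc k)
suc-*-choose zero    zero    = refl
suc-*-choose zero    (suc k) = sym (*-zeroʳ (suc (suc k)))
suc-*-choose (suc n) zero    = trans (*-identityʳ (suc (suc n))) (sym (trans (*-identityˡ _) (n-choose-1 (suc (suc n)))))
suc-*-choose (suc n) (suc k) = sym (begin
    suc (suc k) * (x + y)               ≡⟨ distrib (suc k) x y ⟩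
    x + suc k * x + suc (suc k) * y     ≡⟨ cong₂ (λ u v → x + u + v) (sym (suc-*-choose n k)) (sym (suc-*-choose n (suc k))) ⟩
    x + suc n * a + suc n * b           ≡⟨ regroup (suc n) x a b ⟩
    x + suc n * (a + b)                 ≡⟨⟩
    suc (suc n) * x                     ∎)
  where
  open ≡-Reasoning
  a = n choose k
  b = n choose suc k
  x = suc n choose suc k
  y = suc n choose suc (suc k)
  distrib : ∀ k x y → suc k * (x + y) ≡ x + k * x + suc k * y
  distrib = solve-∀
  regroup : ∀ m x a b → x + m * a + m * b ≡ x + m * (a + b)
  regroup = solve-∀

filter-map : {P : Pred B 0ℓ} (P? : Decidable P) (f : A → B) (xs : List A) →
             filter P? (map f xs) ≡ map f (filter (P? ∘ f) xs)
filter-map P? f []       = refl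
filter-map P? f (x ∷ xs) with does (P? (f x))
... | true  = cong (f x ∷_) (filter-map P? f xs)
... | false = filter-map P? f xs

length-filter-++ : {P : Pred A 0ℓ} (P? : Decidable P) (xs ys : List A) →
                   length (filter P? (xs ++ ys)) ≡ length (filter P? xs) + length (filter P? ys)
length-filter-++ P? xs ys = trans (cong length (filter-++ P? xs ys)) (length-++ (filter P? xs))

length-filter-∪ : {P Q : Pred A 0ℓ} (P? : Decidable P) (Q? : Decidable Q) (xs : List A) →
                  length (filter (P? ∪? Q?) xs) ≤ length (filter P? xs) + length (filter Q? xs)
length-filter-∪ P? Q? []       = z≤n
length-filter-∪ P? Q? (x ∷ xs) with P? x | Q? x
... | yes _ | yes _ = s≤s (≤-trans (length-filter-∪ P? Q? xs) (+-monoʳ-≤ _ (n≤1+n _)))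
... | yes _ | no  _ = s≤s (length-filter-∪ P? Q? xs)
... | no  _ | yes _ = ≤-trans (s≤s (length-filter-∪ P? Q? xs)) (≤-reflexive (sym (+-suc _ _)))
... | no  _ | no  _ = length-filter-∪ P? Q? xs

⊆-filter⁺ : {P : Pred A 0ℓ} (P? : Decidable P) {xs ys : List A} → ys ⊆ xs → All P ys → ys ⊆ filter P? xs
⊆-filter⁺ P? {xs} ys⊆xs Pys =
  subst (_⊆ filter P? xs) (filter-all P? Pys) (Sublist.filter⁺ P? P? (λ { refl → id }) ys⊆xs)

AllPairs-resp-⊇ : {R : A → A → Set} {xs ys : List A} → ys ⊆ xs → AllPairs R xs → AllPairs R ys
AllPairs-resp-⊇ []           []      = []
AllPairs-resp-⊇ (_ ∷ʳ sub)   (_ ∷ p) = AllPairs-resp-⊇ sub p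
AllPairs-resp-⊇ (refl ∷ sub) (h ∷ p) = All-resp-⊆ sub h ∷ AllPairs-resp-⊇ sub p

sum-map≤length : (f : A → ℕ) {xs : List A} → All (λ x → f x ≤ 1) xs → sum (map f xs) ≤ length xs
sum-map≤length f []         = z≤n
sum-map≤length f (fx≤1 ∷ h) = +-mono-≤ fx≤1 (sum-map≤length f h)

sum-map<length : (f : A → ℕ) {xs : List A} {y : A} → y ∈ xs → f y ≡ 0 → All (λ x → f x ≤ 1) xs →
                 sum (map f xs) < length xs
sum-map<length f (here refl) fy≡0 (_ ∷ h) rewrite fy≡0 = s≤s (sum-map≤length f h)
sum-map<length f {x ∷ xs} (there y∈) fy≡0 (fx≤1 ∷ h) =
  subst (_≤ suc (length xs)) (+-suc (f x) (sum (map f xs))) (+-mono-≤ fx≤1 (sum-map<length f y∈ fy≡0 h))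

zipWith-injective : ∀ {C : Set} {f : A → B → C} → (∀ {a a′ b b′} → f a b ≡ f a′ b′ → a ≡ a′ × b ≡ b′) →
  ∀ xs ys xs′ ys′ → length xs ≡ length ys → length xs′ ≡ length ys′ →
  zipWith f xs ys ≡ zipWith f xs′ ys′ → xs ≡ xs′ × ys ≡ ys′
zipWith-injective inj []       []       []         []         _ _ _  = refl , refl
zipWith-injective inj (x ∷ xs) (y ∷ ys) (x′ ∷ xs′) (y′ ∷ ys′) l l′ eq =
  let x≡x′ , y≡y′ = inj (∷-injectiveˡ eq)
      xs≡xs′ , ys≡ys′ = zipWith-injective inj xs ys xs′ ys′ (suc-injective l) (suc-injective l′) (∷-injectiveʳ eq)
  in cong₂ _∷_ x≡x′ xs≡xs′ , cong₂ _∷_ y≡y′ ys≡ys′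
zipWith-injective inj []       (_ ∷ _)  _          _          () _ _
zipWith-injective inj (_ ∷ _)  []       _          _          () _ _
zipWith-injective inj _        _        []         (_ ∷ _)    _ () _
zipWith-injective inj _        _        (_ ∷ _)    []         _ () _
zipWith-injective inj []       []       (_ ∷ _)    (_ ∷ _)    _ _ ()
zipWith-injective inj (_ ∷ _)  (_ ∷ _)  []         []         _ _ ()

Unique-map-on : (f : A → B) {xs : List A} → (∀ {a b} → a ∈ xs → b ∈ xs → f a ≡ f b → a ≡ b) →
                Unique xs → Unique (map f xs)
Unique-map-on f         _   []         = []
Unique-map-on f {x ∷ xs} inj (x∉xs ∷ u) =
  All.map⁺ (All.tabulate (λ y∈ fx≡fy → All.lookup x∉xs y∈ (inj (here refl) (there y∈) fx≡fy)))
  ∷ Unique-map-on f (λ a∈ b∈ → inj (there a∈) (there b∈)) u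

Unique⇒length≤ : {xs ys : List A} → Unique xs → All (_∈ ys) xs → length xs ≤ length ys
Unique⇒length≤ []                 []           = z≤n
Unique⇒length≤ {xs = x ∷ xs} (x∉xs ∷ u) (x∈ys ∷ xs⊆ys) with ∈-∃++ x∈ys
... | ys₁ , ys₂ , refl = begin
    suc (length xs)               ≤⟨ s≤s (Unique⇒length≤ u (All.tabulate (λ z∈ → remove (All.lookup xs⊆ys z∈) (All.lookup x∉xs z∈ ∘ sym)))) ⟩
    suc (length (ys₁ ++ ys₂))     ≡⟨ cong suc (length-++ ys₁) ⟩
    suc (length ys₁ + length ys₂) ≡⟨ +-suc (length ys₁) (length ys₂) ⟨
    length ys₁ + length (x ∷ ys₂) ≡⟨ length-++ ys₁ ⟨
    length (ys₁ ++ x ∷ ys₂)       ∎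
  where
  open ≤-Reasoning
  remove : ∀ {zs₁ zs₂ z} → z ∈ zs₁ ++ x ∷ zs₂ → z ≢ x → z ∈ zs₁ ++ zs₂
  remove {[]}     (here refl) z≢x = ⊥-elim (z≢x refl)
  remove {[]}     (there z∈)  _   = z∈
  remove {_ ∷ _}  (here refl) _   = here refl
  remove {_ ∷ _}  (there z∈)  z≢x = there (remove z∈ z≢x)

length-cartesianProduct : (xs : List A) (ys : List B) → length (cartesianProduct xs ys) ≡ length xs * length ys
length-cartesianProduct []       ys = refl
length-cartesianProduct (x ∷ xs) ys =
  trans (length-++ (map (x ,_) ys)) (cong₂ _+_ (length-map _ ys) (length-cartesianProduct xs ys))

union-bound :
  ∀ m {G : Pred A 0ℓ} (G? : Decidable G) {P : Fin m → Pred A 0ℓ} (P? : ∀ j → Decidable (P j)) {c} (xs : List A) →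
  (∀ {x} → ¬ G x → Σ (Fin m) λ j → P j x) → (∀ j → length (filter (P? j) xs) ≤ c) →
  length xs ≤ length (filter G? xs) + m * c
union-bound zero {G} G? P? xs cover _ = begin
    length xs                  ≡⟨ cong length (filter-all G? (All.universal always xs)) ⟨
    length (filter G? xs)      ≡⟨ +-identityʳ _ ⟨
    length (filter G? xs) + 0  ∎
  where
  open ≤-Reasoning
  always : ∀ x → G x
  always x with G? x
  ... | yes g = g
  ... | no ¬g with () ← proj₁ (cover ¬g)
union-bound (suc m) {G} G? {P} P? {c} xs cover bounded = begin
    length xs                                                     ≤⟨ union-bound m (G? ∪? P? zero) (P? ∘ suc) xs cover′ (bounded ∘ suc) ⟩
    length (filter (G? ∪? P? zero) xs) + m * c                    ≤⟨ +-monoˡ-≤ (m * c) (length-filter-∪ G? (P? zero) xs) ⟩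
    length (filter G? xs) + length (filter (P? zero) xs) + m * c  ≤⟨ +-monoˡ-≤ (m * c) (+-monoʳ-≤ _ (bounded zero)) ⟩
    length (filter G? xs) + c + m * c                             ≡⟨ +-assoc (length (filter G? xs)) c (m * c) ⟩
    length (filter G? xs) + suc m * c                             ∎
  where
  open ≤-Reasoning
  cover′ : ∀ {x} → ¬ (G ∪ P zero) x → Σ (Fin m) λ j → P (suc j) x
  cover′ ¬gp with cover (¬gp ∘ inj₁)
  ... | zero  , p₀ = ⊥-elim (¬gp (inj₂ p₀))
  ... | suc j , pⱼ = j , pⱼ

∈-combinations⁻ : ∀ m (xs : List A) {ys} → ys ∈ combinations m xs → length ys ≡ m × ys ⊆ xs
∈-combinations⁻ zero    xs       (here refl) = refl , minimum xs
∈-combinations⁻ (suc m) (x ∷ xs) p with ∈-++⁻ (map (x ∷_) (combinations m xs)) p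
... | inj₁ q with ∈-map⁻ (x ∷_) q
...   | zs , zs∈ , refl = let l , sub = ∈-combinations⁻ m xs zs∈ in cong suc l , refl ∷ sub
∈-combinations⁻ (suc m) (x ∷ xs) p | inj₂ q = let l , sub = ∈-combinations⁻ (suc m) xs q in l , x ∷ʳ sub

⊆⇒∈-combinations : {xs ys : List A} → ys ⊆ xs → ys ∈ combinations (length ys) xs
⊆⇒∈-combinations {ys = []}    _          = here refl
⊆⇒∈-combinations {ys = _ ∷ _} (_ ∷ʳ sub) = ∈-++⁺ʳ _ (⊆⇒∈-combinations sub)
⊆⇒∈-combinations {ys = _ ∷ _} (refl ∷ sub) = ∈-++⁺ˡ (∈-map⁺ _ (⊆⇒∈-combinations sub))

length-combinations : ∀ m (xs : List A) → length (combinations m xs) ≡ length xs choose m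
length-combinations zero    xs       = refl
length-combinations (suc m) []       = refl
length-combinations (suc m) (x ∷ xs) = trans (length-++ (map (x ∷_) (combinations m xs)))
  (cong₂ _+_ (trans (length-map _ (combinations m xs)) (length-combinations m xs)) (length-combinations (suc m) xs))

Unique-combinations : ∀ m {xs : List A} → Unique xs → Unique (combinations m xs)
Unique-combinations zero    _ = [] ∷ []
Unique-combinations (suc m) [] = []
Unique-combinations (suc m) {x ∷ xs} (x∉xs ∷ u) =
  Unique.++⁺ (Unique.map⁺ ∷-injectiveʳ (Unique-combinations m u)) (Unique-combinations (suc m) u) disjoint
  where
  disjoint : ∀ {ys} → ¬ (ys ∈ map (x ∷_) (combinations m xs) × ys ∈ combinations (suc m) xs)
  disjoint (p , q) with ∈-map⁻ (x ∷_) p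
  ... | _ , _ , refl = All.lookup x∉xs (Any-resp-⊆ (proj₂ (∈-combinations⁻ (suc m) xs q)) (here refl)) refl

filter-combinations-cons : {D : Pred (List A) 0ℓ} (D? : Decidable D) (m : ℕ) (x : A) (xs : List A) →
  filter D? (combinations (suc m) (x ∷ xs))
    ≡ map (x ∷_) (filter (D? ∘ (x ∷_)) (combinations m xs)) ++ filter D? (combinations (suc m) xs)
filter-combinations-cons D? m x xs =
  trans (filter-++ D? (map (x ∷_) (combinations m xs)) _)
        (cong (_++ filter D? (combinations (suc m) xs)) (filter-map D? (x ∷_) (combinations m xs)))

filter-combinations-restrict :
  {P Q : Pred A 0ℓ} (P? : Decidable P) (Q? : Decidable Q) → (∀ {x} → Q x → P x) →
  {D : Pred (List A) 0ℓ} (D? : Decidable D) (m : ℕ) (xs : List A) →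
  (∀ ys → length ys ≡ m → All P ys → D ys → All Q ys) →
  filter D? (combinations m (filter P? xs)) ≡ filter D? (combinations m (filter Q? xs))
filter-combinations-restrict P? Q? Q⇒P D? zero    xs       forces = refl
filter-combinations-restrict P? Q? Q⇒P D? (suc m) []       forces = refl
filter-combinations-restrict {P = P} {Q} P? Q? Q⇒P {D} D? (suc m) (x ∷ xs) forces with P? x | Q? x
... | no ¬p | no _  = filter-combinations-restrict P? Q? Q⇒P D? (suc m) xs forces
... | no ¬p | yes q = ⊥-elim (¬p (Q⇒P q))
... | yes p | yes q = begin
    filter D? (combinations (suc m) (x ∷ filter P? xs))
      ≡⟨ filter-combinations-cons D? m x (filter P? xs) ⟩
    map (x ∷_) (filter (D? ∘ (x ∷_)) (combinations m (filter P? xs))) ++ filter D? (combinations (suc m) (filter P? xs))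
      ≡⟨ cong₂ (λ u v → map (x ∷_) u ++ v)
           (filter-combinations-restrict P? Q? Q⇒P (D? ∘ (x ∷_)) m xs forces-tail)
           (filter-combinations-restrict P? Q? Q⇒P D? (suc m) xs forces) ⟩
    map (x ∷_) (filter (D? ∘ (x ∷_)) (combinations m (filter Q? xs))) ++ filter D? (combinations (suc m) (filter Q? xs))
      ≡⟨ filter-combinations-cons D? m x (filter Q? xs) ⟨
    filter D? (combinations (suc m) (x ∷ filter Q? xs)) ∎
  where
  open ≡-Reasoning
  forces-tail : ∀ ys → length ys ≡ m → All P ys → D (x ∷ ys) → All Q ys
  forces-tail ys l ps d = All.tail (forces (x ∷ ys) (cong suc l) (p ∷ ps) d)
... | yes p | no ¬q = begin
    filter D? (combinations (suc m) (x ∷ filter P? xs))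
      ≡⟨ filter-combinations-cons D? m x (filter P? xs) ⟩
    map (x ∷_) (filter (D? ∘ (x ∷_)) (combinations m (filter P? xs))) ++ filter D? (combinations (suc m) (filter P? xs))
      ≡⟨ cong (λ u → map (x ∷_) u ++ _) (filter-none (D? ∘ (x ∷_)) (All.tabulate ¬D)) ⟩
    filter D? (combinations (suc m) (filter P? xs))
      ≡⟨ filter-combinations-restrict P? Q? Q⇒P D? (suc m) xs forces ⟩
    filter D? (combinations (suc m) (filter Q? xs)) ∎
  where
  open ≡-Reasoning
  ¬D : ∀ {ys} → ys ∈ combinations m (filter P? xs) → ¬ D (x ∷ ys)
  ¬D ys∈ d = let l , sub = ∈-combinations⁻ m (filter P? xs) ys∈ in
    ¬q (All.head (forces (x ∷ _) (cong suc l) (p ∷ All-resp-⊆ sub (All.all-filter P? xs)) d))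

prependEach : List A → List (List A) → List (List A)
prependEach xs T = concatMap (λ x → map (x ∷_) T) xs

∈-prependEach⁻ : (xs : List A) (T : List (List A)) {zs : List A} → zs ∈ prependEach xs T →
                 Σ A λ y → y ∈ xs × Σ (List A) λ ys → ys ∈ T × zs ≡ y ∷ ys
∈-prependEach⁻ (x ∷ xs) T p with ∈-++⁻ (map (x ∷_) T) p
... | inj₁ q = let ys , ys∈ , eq = ∈-map⁻ (x ∷_) q in x , here refl , ys , ys∈ , eq
... | inj₂ q = let y , y∈ , rest = ∈-prependEach⁻ xs T q in y , there y∈ , rest

length-prependEach : (xs : List A) (T : List (List A)) → length (prependEach xs T) ≡ length xs * length T
length-prependEach []       T = refl
length-prependEach (x ∷ xs) T =
  trans (length-++ (map (x ∷_) T)) (cong₂ _+_ (length-map (x ∷_) T) (length-prependEach xs T))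

length-filter-all-prependEach : {Q : Pred A 0ℓ} (Q? : Decidable Q) (xs : List A) (T : List (List A)) →
  length (filter (all? Q?) (prependEach xs T)) ≡ length (filter Q? xs) * length (filter (all? Q?) T)
length-filter-all-prependEach Q? []       T = refl
length-filter-all-prependEach Q? (y ∷ ys) T with Q? y
... | yes q = trans (length-filter-++ (all? Q?) (map (y ∷_) T) (prependEach ys T))
                    (cong₂ _+_ kept (length-filter-all-prependEach Q? ys T))
  where
  kept : length (filter (all? Q?) (map (y ∷_) T)) ≡ length (filter (all? Q?) T)
  kept = trans (cong length (filter-map (all? Q?) (y ∷_) T))
    (trans (length-map (y ∷_) (filter (all? Q? ∘ (y ∷_)) T)) (cong length (filter-≐ _ (all? Q?) (All.tail , q ∷_) T)))
... | no ¬q = trans (length-filter-++ (all? Q?) (map (y ∷_) T) (prependEach ys T))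
                    (cong₂ _+_ dropped (length-filter-all-prependEach Q? ys T))
  where
  dropped : length (filter (all? Q?) (map (y ∷_) T)) ≡ 0
  dropped = cong length (filter-none (all? Q?) (All.map⁺ (All.universal (λ _ → ¬q ∘ All.head) T)))

Unique-prependEach : {xs : List A} {T : List (List A)} → Unique xs → Unique T → Unique (prependEach xs T)
Unique-prependEach                 []           _  = []
Unique-prependEach {xs = y ∷ ys} {T} (y∉ys ∷ uys) uT =
  Unique.++⁺ (Unique.map⁺ ∷-injectiveʳ uT) (Unique-prependEach uys uT) disjoint
  where
  disjoint : ∀ {zs} → ¬ (zs ∈ map (y ∷_) T × zs ∈ prependEach ys T)
  disjoint (p , q) with ∈-map⁻ (y ∷_) p | ∈-prependEach⁻ ys T q
  ... | _ , _ , refl | _ , y∈ys , _ , _ , refl = All.lookup y∉ys y∈ys refl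

∈-tuples⁻ : ∀ p (xs : List A) {ys} → ys ∈ tuples p xs → length ys ≡ p × All (_∈ xs) ys
∈-tuples⁻ zero    xs (here refl) = refl , []
∈-tuples⁻ (suc p) xs q with ∈-prependEach⁻ xs (tuples p xs) q
... | y , y∈ , ys , ys∈ , refl = let l , ∈xs = ∈-tuples⁻ p xs ys∈ in cong suc l , y∈ ∷ ∈xs

length-tuples : ∀ p (xs : List A) → length (tuples p xs) ≡ length xs ^ p
length-tuples zero    xs = refl
length-tuples (suc p) xs = trans (length-prependEach xs (tuples p xs)) (cong (length xs *_) (length-tuples p xs))

length-filter-all-tuples : {Q : Pred A 0ℓ} (Q? : Decidable Q) (p : ℕ) (xs : List A) →
                           length (filter (all? Q?) (tuples p xs)) ≡ length (filter Q? xs) ^ p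
length-filter-all-tuples Q? zero    xs = refl
length-filter-all-tuples Q? (suc p) xs = trans (length-filter-all-prependEach Q? xs (tuples p xs))
  (cong (length (filter Q? xs) *_) (length-filter-all-tuples Q? p xs))

Unique-tuples : ∀ p {xs : List A} → Unique xs → Unique (tuples p xs)
Unique-tuples zero    _ = [] ∷ []
Unique-tuples (suc p) u = Unique-prependEach u (Unique-tuples p u)

∣p++q∣≡∣p∣+∣q∣ : ∀ {m n} (p : Subset m) (q : Subset n) → ∣ p ++ᵥ q ∣ ≡ ∣ p ∣ + ∣ q ∣
∣p++q∣≡∣p∣+∣q∣ []            q = refl
∣p++q∣≡∣p∣+∣q∣ (inside  ∷ p) q = cong suc (∣p++q∣≡∣p∣+∣q∣ p q)
∣p++q∣≡∣p∣+∣q∣ (outside ∷ p) q = ∣p++q∣≡∣p∣+∣q∣ p q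

∩-++ : ∀ {m n} (p p′ : Subset m) (q q′ : Subset n) → (p ++ᵥ q) ∩ (p′ ++ᵥ q′) ≡ (p ∩ p′) ++ᵥ (q ∩ q′)
∩-++ []      []       q q′ = refl
∩-++ (x ∷ p) (y ∷ p′) q q′ = cong ((x ∧ y) ∷_) (∩-++ p p′ q q′)

⊤-++ : ∀ m n → ⊤ {m + n} ≡ ⊤ {m} ++ᵥ ⊤ {n}
⊤-++ zero    n = refl
⊤-++ (suc m) n = cong (inside ∷_) (⊤-++ m n)

x∈⋂⁻ : ∀ {n} {x : Fin n} (ps : List (Subset n)) → x ∈ₛ ⋂ ps → All (x ∈ₛ_) ps
x∈⋂⁻ []       _   = []
x∈⋂⁻ (p ∷ ps) x∈ = let x∈p , x∈⋂ps = x∈p∩q⁻ p (⋂ ps) x∈ in x∈p ∷ x∈⋂⁻ ps x∈⋂ps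

∣p∣≢0⇒Nonempty : ∀ {n} (p : Subset n) → ∣ p ∣ ≢ 0 → Nonempty p
∣p∣≢0⇒Nonempty {n} p ∣p∣≢0 with nonempty? p
... | yes ne = ne
... | no  ¬ne = ⊥-elim (∣p∣≢0 (trans (cong ∣_∣ (Empty-unique ¬ne)) (∣⊥∣≡0 n)))

∣p∩r∣+∣q∩r∣≤∣r∣+∣p∩q∩r∣ : ∀ {n} (p q r : Subset n) → ∣ p ∩ r ∣ + ∣ q ∩ r ∣ ≤ ∣ r ∣ + ∣ (p ∩ q) ∩ r ∣
∣p∩r∣+∣q∩r∣≤∣r∣+∣p∩q∩r∣ []            []            []            = z≤n
∣p∩r∣+∣q∩r∣≤∣r∣+∣p∩q∩r∣ (inside  ∷ p) (inside  ∷ q) (outside ∷ r) = ∣p∩r∣+∣q∩r∣≤∣r∣+∣p∩q∩r∣ p q r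
∣p∩r∣+∣q∩r∣≤∣r∣+∣p∩q∩r∣ (inside  ∷ p) (outside ∷ q) (outside ∷ r) = ∣p∩r∣+∣q∩r∣≤∣r∣+∣p∩q∩r∣ p q r
∣p∩r∣+∣q∩r∣≤∣r∣+∣p∩q∩r∣ (outside ∷ p) (inside  ∷ q) (outside ∷ r) = ∣p∩r∣+∣q∩r∣≤∣r∣+∣p∩q∩r∣ p q r
∣p∩r∣+∣q∩r∣≤∣r∣+∣p∩q∩r∣ (outside ∷ p) (outside ∷ q) (outside ∷ r) = ∣p∩r∣+∣q∩r∣≤∣r∣+∣p∩q∩r∣ p q r
∣p∩r∣+∣q∩r∣≤∣r∣+∣p∩q∩r∣ (inside  ∷ p) (inside  ∷ q) (inside  ∷ r) =
  s≤s (subst₂ _≤_ (sym (+-suc _ _)) (sym (+-suc _ _)) (s≤s (∣p∩r∣+∣q∩r∣≤∣r∣+∣p∩q∩r∣ p q r)))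
∣p∩r∣+∣q∩r∣≤∣r∣+∣p∩q∩r∣ (inside  ∷ p) (outside ∷ q) (inside  ∷ r) = s≤s (∣p∩r∣+∣q∩r∣≤∣r∣+∣p∩q∩r∣ p q r)
∣p∩r∣+∣q∩r∣≤∣r∣+∣p∩q∩r∣ (outside ∷ p) (inside  ∷ q) (inside  ∷ r) =
  subst (_≤ suc (∣ r ∣ + ∣ (p ∩ q) ∩ r ∣)) (sym (+-suc _ _)) (s≤s (∣p∩r∣+∣q∩r∣≤∣r∣+∣p∩q∩r∣ p q r))
∣p∩r∣+∣q∩r∣≤∣r∣+∣p∩q∩r∣ (outside ∷ p) (outside ∷ q) (inside  ∷ r) = m≤n⇒m≤1+n (∣p∩r∣+∣q∩r∣≤∣r∣+∣p∩q∩r∣ p q r)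

-- `⌊_⌋` does not compute on an open decision, `does` does.
initSeg-suc : ∀ n m → initSeg (suc n) (suc m) ≡ inside ∷ initSeg n m
initSeg-suc n m = cong (inside ∷_) (tabulate-cong λ i →
  trans (isYes≗does (suc (toℕ i) <? suc m)) (sym (isYes≗does (toℕ i <? m))))

initSeg-zero : ∀ n → initSeg n 0 ≡ ⊥
initSeg-zero zero    = refl
initSeg-zero (suc n) = cong (outside ∷_) (initSeg-zero n)

initSeg-+ : ∀ c m → initSeg (c + m) c ≡ ⊤ {c} ++ᵥ ⊥ {m}
initSeg-+ zero    m = initSeg-zero m
initSeg-+ (suc c) m = trans (initSeg-suc (c + m) c) (cong (inside ∷_) (initSeg-+ c m))

∣initSeg∣ : ∀ {n m} → m ≤ n → ∣ initSeg n m ∣ ≡ m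
∣initSeg∣ {n} {zero}      _         = trans (cong ∣_∣ (initSeg-zero n)) (∣⊥∣≡0 n)
∣initSeg∣ {suc n} {suc m} (s≤s m≤n) = trans (cong ∣_∣ (initSeg-suc n m)) (cong suc (∣initSeg∣ m≤n))

Unique-allSubsets : ∀ n → Unique (allSubsets n)
Unique-allSubsets zero    = [] ∷ []
Unique-allSubsets (suc n) =
  Unique.++⁺ (Unique.map⁺ ∷-injectiveʳᵥ (Unique-allSubsets n)) (Unique.map⁺ ∷-injectiveʳᵥ (Unique-allSubsets n)) disjoint
  where
  disjoint : ∀ {p} → ¬ (p ∈ map (inside ∷_) (allSubsets n) × p ∈ map (outside ∷_) (allSubsets n))
  disjoint (p∈ , q∈) with ∈-map⁻ (inside ∷_) p∈ | ∈-map⁻ (outside ∷_) q∈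
  ... | _ , _ , refl | _ , _ , ()

Unique-kSubsets : ∀ n k → Unique (kSubsets n k)
Unique-kSubsets n k = Unique.filter⁺ _ (Unique-allSubsets n)

kSubsets-suc : ∀ m s → kSubsets (suc m) (suc s) ≡ map (inside ∷_) (kSubsets m s) ++ map (outside ∷_) (kSubsets m (suc s))
kSubsets-suc m s = trans (filter-++ (λ p → ∣ p ∣ ≟ suc s) (map (inside ∷_) (allSubsets m)) _)
  (cong₂ _++_ (trans (filter-map (λ p → ∣ p ∣ ≟ suc s) (inside ∷_) (allSubsets m))
                     (cong (map (inside ∷_)) (filter-≐ _ _ (suc-injective , cong suc) (allSubsets m))))
              (filter-map (λ p → ∣ p ∣ ≟ suc s) (outside ∷_) (allSubsets m)))

kSubsets-suc-zero : ∀ m → kSubsets (suc m) 0 ≡ map (outside ∷_) (kSubsets m 0)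
kSubsets-suc-zero m = trans (filter-++ (λ p → ∣ p ∣ ≟ 0) (map (inside ∷_) (allSubsets m)) _)
  (cong₂ _++_ (trans (filter-map (λ p → ∣ p ∣ ≟ 0) (inside ∷_) (allSubsets m))
                     (cong (map (inside ∷_)) (filter-none _ (All.universal (λ _ ()) (allSubsets m)))))
              (filter-map (λ p → ∣ p ∣ ≟ 0) (outside ∷_) (allSubsets m)))

length-kSubsets : ∀ m s → length (kSubsets m s) ≡ m choose s
length-kSubsets zero    zero    = refl
length-kSubsets zero    (suc s) = refl
length-kSubsets (suc m) zero    =
  trans (cong length (kSubsets-suc-zero m)) (trans (length-map _ (kSubsets m 0)) (length-kSubsets m 0))
length-kSubsets (suc m) (suc s) = begin
  length (kSubsets (suc m) (suc s))                         ≡⟨ cong length (kSubsets-suc m s) ⟩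
  length (map (inside ∷_) ps ++ map (outside ∷_) qs)        ≡⟨ length-++ (map (inside ∷_) ps) ⟩
  length (map (inside ∷_) ps) + length (map (outside ∷_) qs) ≡⟨ cong₂ _+_ (length-map _ ps) (length-map _ qs) ⟩
  length ps + length qs                                     ≡⟨ cong₂ _+_ (length-kSubsets m s) (length-kSubsets m (suc s)) ⟩
  m choose s + m choose suc s                               ∎
  where
  open ≡-Reasoning
  ps = kSubsets m s
  qs = kSubsets m (suc s)

length-kSubsets-∋ : ∀ m s (j : Fin (suc m)) → length (filter (j ∈?_) (kSubsets (suc m) (suc s))) ≡ m choose s
length-kSubsets-∋ m s zero = begin
    length (filter (zero ∈?_) (kSubsets (suc m) (suc s)))
      ≡⟨ cong (length ∘ filter (zero ∈?_)) (kSubsets-suc m s) ⟩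
    length (filter (zero ∈?_) (map (inside ∷_) ps ++ map (outside ∷_) qs))
      ≡⟨ length-filter-++ (zero ∈?_) (map (inside ∷_) ps) (map (outside ∷_) qs) ⟩
    length (filter (zero ∈?_) (map (inside ∷_) ps)) + length (filter (zero ∈?_) (map (outside ∷_) qs))
      ≡⟨ cong₂ (λ u v → length u + length v)
           (filter-all (zero ∈?_) (All.map⁺ (All.universal (λ _ → here) ps)))
           (filter-none (zero ∈?_) (All.map⁺ (All.universal (λ _ ()) qs))) ⟩
    length (map (inside ∷_) ps) + 0
      ≡⟨ +-identityʳ _ ⟩
    length (map (inside ∷_) ps)
      ≡⟨ trans (length-map _ ps) (length-kSubsets m s) ⟩
    m choose s ∎
  where
  open ≡-Reasoning
  ps = kSubsets m s
  qs = kSubsets m (suc s)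
length-kSubsets-∋ (suc m) s (suc j) = begin
    length (filter (suc j ∈?_) (kSubsets (suc (suc m)) (suc s)))
      ≡⟨ cong (length ∘ filter (suc j ∈?_)) (kSubsets-suc (suc m) s) ⟩
    length (filter (suc j ∈?_) (map (inside ∷_) ps ++ map (outside ∷_) qs))
      ≡⟨ length-filter-++ (suc j ∈?_) (map (inside ∷_) ps) (map (outside ∷_) qs) ⟩
    length (filter (suc j ∈?_) (map (inside ∷_) ps)) + length (filter (suc j ∈?_) (map (outside ∷_) qs))
      ≡⟨ cong₂ _+_ (drop-head ps) (trans (drop-head qs) (length-kSubsets-∋ m s j)) ⟩
    length (filter (j ∈?_) ps) + m choose s
      ≡⟨ pascal s ⟩
    suc m choose s ∎
  where
  open ≡-Reasoning
  ps = kSubsets (suc m) s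
  qs = kSubsets (suc m) (suc s)
  drop-head : ∀ {x} ps → length (filter (suc j ∈?_) (map (x ∷_) ps)) ≡ length (filter (j ∈?_) ps)
  drop-head {x} ps = trans (cong length (filter-map (suc j ∈?_) (x ∷_) ps))
    (trans (length-map (x ∷_) (filter ((suc j ∈?_) ∘ (x ∷_)) ps)) (cong length (filter-≐ _ _ (drop-there , there) ps)))
  pascal : ∀ s → length (filter (j ∈?_) (kSubsets (suc m) s)) + m choose s ≡ suc m choose s
  pascal zero    = cong (_+ 1) (cong length (filter-none (j ∈?_) (All.tabulate j∉)))
    where
    j∉ : ∀ {p} → p ∈ kSubsets (suc m) 0 → ¬ j ∈ₛ p
    j∉ {p} p∈ j∈p = n≮0 (subst (∣ p - j ∣ <_) (proj₂ (∈-filter⁻ (λ p → ∣ p ∣ ≟ 0) {xs = allSubsets (suc m)} p∈)) (x∈p⇒∣p-x∣<∣p∣ j∈p))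
  pascal (suc s) = cong (_+ m choose suc s) (length-kSubsets-∋ m s j)

-- The lexicographic order, with `inside` before `outside`, in which `allSubsets` lists the subsets.
data _≺_ : ∀ {n} → Subset n → Subset n → Set where
  in≺out : ∀ {n} {p q : Subset n} → (inside ∷ p) ≺ (outside ∷ q)
  ∷≺∷    : ∀ {n x} {p q : Subset n} → p ≺ q → (x ∷ p) ≺ (x ∷ q)

∷≺∷⁻ : ∀ {n x} {p q : Subset n} → (x ∷ p) ≺ (x ∷ q) → p ≺ q
∷≺∷⁻ (∷≺∷ p≺q) = p≺q

≺-++ : ∀ {m n} {p q : Subset m} (u v : Subset n) → p ≺ q → (p ++ᵥ u) ≺ (q ++ᵥ v)
≺-++ u v in≺out    = in≺out
≺-++ u v (∷≺∷ p≺q) = ∷≺∷ (≺-++ u v p≺q)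

data InsideThenOutside {n} : List (Subset (suc n)) → Set where
  split : ∀ ps qs → AllPairs _≺_ ps → AllPairs _≺_ qs →
          InsideThenOutside (map (inside ∷_) ps ++ map (outside ∷_) qs)

insideThenOutside : ∀ {n} (ps : List (Subset (suc n))) → AllPairs _≺_ ps → InsideThenOutside ps
insideThenOutside []                  _               = split [] [] [] []
insideThenOutside ((inside ∷ p) ∷ ps) (p≺ps ∷ sorted) with insideThenOutside ps sorted
... | split us vs us-sorted vs-sorted =
  split (p ∷ us) vs (All.map ∷≺∷⁻ (All.map⁻ (All.++⁻ˡ (map (inside ∷_) us) p≺ps)) ∷ us-sorted) vs-sorted
insideThenOutside ((outside ∷ p) ∷ ps) (p≺ps ∷ sorted) with insideThenOutside ps sorted
... | split []      vs us-sorted vs-sorted = split [] (p ∷ vs) us-sorted (All.map ∷≺∷⁻ (All.map⁻ p≺ps) ∷ vs-sorted)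
... | split (_ ∷ _) vs _         _ with p≺ps
...   | () ∷ _

sorted⇒⊆allSubsets : ∀ n {ps : List (Subset n)} → AllPairs _≺_ ps → ps ⊆ allSubsets n
sorted⇒⊆allSubsets zero    {[]}           _                  = [] ∷ʳ []
sorted⇒⊆allSubsets zero    {[] ∷ []}      _                  = refl ∷ []
sorted⇒⊆allSubsets zero    {[] ∷ [] ∷ _}  ((() ∷ _) ∷ _)
sorted⇒⊆allSubsets (suc n) {ps}           sorted with insideThenOutside ps sorted
... | split us vs us-sorted vs-sorted =
  Sublist.++⁺ (Sublist.map⁺ (inside ∷_) (sorted⇒⊆allSubsets n us-sorted))
              (Sublist.map⁺ (outside ∷_) (sorted⇒⊆allSubsets n vs-sorted))

-- Intersections of sets that almost contain a given set

deficit : ∀ {n} → Subset n → Subset n → ℕ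
deficit s p = ∣ s ∣ ∸ ∣ p ∩ s ∣

deficit≤1 : ∀ {n} (s p : Subset n) → ∣ s ∣ ∸ 1 ≤ ∣ p ∩ s ∣ → deficit s p ≤ 1
deficit≤1 s p h = m≤n+o⇒m∸n≤o ∣ s ∣ ∣ p ∩ s ∣ (begin
  ∣ s ∣               ≤⟨ m≤n+m∸n ∣ s ∣ 1 ⟩
  1 + (∣ s ∣ ∸ 1)     ≤⟨ +-monoʳ-≤ 1 h ⟩
  1 + ∣ p ∩ s ∣       ≡⟨ +-comm 1 _ ⟩
  ∣ p ∩ s ∣ + 1       ∎)
  where open ≤-Reasoning

∣s∣≤∑deficit+∣⋂∣ : ∀ {n} (s : Subset n) (ps : List (Subset n)) → ∣ s ∣ ≤ sum (map (deficit s) ps) + ∣ ⋂ ps ∣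
∣s∣≤∑deficit+∣⋂∣ s ps = ≤-trans (within ps) (+-monoʳ-≤ _ (∣p∩q∣≤∣p∣ (⋂ ps) s))
  where
  within : ∀ ps → ∣ s ∣ ≤ sum (map (deficit s) ps) + ∣ ⋂ ps ∩ s ∣
  within []       = ≤-reflexive (cong ∣_∣ (sym (∩-identityˡ s)))
  within (p ∷ ps) = +-cancelˡ-≤ ∣ s ∣ ∣ s ∣ _ (begin
      ∣ s ∣ + ∣ s ∣              ≤⟨ +-mono-≤ (≤-reflexive (sym (m∸n+n≡m (∣p∩q∣≤∣q∣ p s)))) (within ps) ⟩
      (e + a) + (d + b)          ≡⟨ swap e a d b ⟩
      (e + d) + (a + b)          ≤⟨ +-monoʳ-≤ (e + d) (∣p∩r∣+∣q∩r∣≤∣r∣+∣p∩q∩r∣ p (⋂ ps) s) ⟩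
      (e + d) + (∣ s ∣ + x)      ≡⟨ swap e d ∣ s ∣ x ⟩
      (e + ∣ s ∣) + (d + x)      ≡⟨ swap′ e ∣ s ∣ d x ⟩
      ∣ s ∣ + ((e + d) + x)      ∎)
    where
    open ≤-Reasoning
    e = deficit s p
    a = ∣ p ∩ s ∣
    d = sum (map (deficit s) ps)
    b = ∣ ⋂ ps ∩ s ∣
    x = ∣ (p ∩ ⋂ ps) ∩ s ∣
    swap : ∀ e a d b → (e + a) + (d + b) ≡ (e + d) + (a + b)
    swap = solve-∀
    swap′ : ∀ e s d x → (e + s) + (d + x) ≡ s + ((e + d) + x)
    swap′ = solve-∀

∣⋂∣-lower-bound : ∀ {n} (s : Subset n) (ps : List (Subset n)) → All (λ p → ∣ s ∣ ∸ 1 ≤ ∣ p ∩ s ∣) ps →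
                  ∣ s ∣ ≤ length ps + ∣ ⋂ ps ∣
∣⋂∣-lower-bound s ps meets =
  ≤-trans (∣s∣≤∑deficit+∣⋂∣ s ps) (+-monoˡ-≤ _ (sum-map≤length (deficit s) (All.map (λ {p} → deficit≤1 s p) meets)))

∣⋂∣-lower-bound-strict : ∀ {n} (s : Subset n) (ps : List (Subset n)) → All (λ p → ∣ s ∣ ∸ 1 ≤ ∣ p ∩ s ∣) ps →
                         ∀ {q} → q ∈ ps → ∣ s ∣ ≤ ∣ q ∩ s ∣ → ∣ s ∣ < length ps + ∣ ⋂ ps ∣
∣⋂∣-lower-bound-strict s ps meets q∈ps s⊆q =
  ≤-trans (s≤s (∣s∣≤∑deficit+∣⋂∣ s ps))
          (+-monoˡ-≤ _ (sum-map<length (deficit s) q∈ps (m≤n⇒m∸n≡0 s⊆q) (All.map (λ {p} → deficit≤1 s p) meets)))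

∣∩s∣≡∣s∣∸1⇒RWiseTIntersecting : ∀ {n} r t (s : Subset n) → ∣ s ∣ ≡ r + t → (Fs : List (Subset n)) →
  All (λ F → ∣ F ∩ s ∣ ≡ r + t ∸ 1) Fs → RWiseTIntersecting r t Fs
∣∩s∣≡∣s∣∸1⇒RWiseTIntersecting r t s ∣s∣≡r+t Fs exact = All.tabulate λ {Hs} Hs∈ →
  let len , Hs⊆Fs = ∈-tuples⁻ r Fs Hs∈
      meets = All.map (λ {H} H∈ → ≤-reflexive (trans (cong (_∸ 1) ∣s∣≡r+t) (sym (All.lookup exact H∈)))) Hs⊆Fs
  in +-cancelˡ-≤ r t _ (begin
    r + t                ≡⟨ ∣s∣≡r+t ⟨
    ∣ s ∣                ≤⟨ ∣⋂∣-lower-bound s Hs meets ⟩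
    length Hs + ∣ ⋂ Hs ∣ ≡⟨ cong (_+ ∣ ⋂ Hs ∣) len ⟩
    r + ∣ ⋂ Hs ∣         ∎)
  where open ≤-Reasoning

-- Triangles of G′ lie in G

N-G′≡N-G : ∀ n k r t → 1 ≤ t → r + t ≤ n → N r t (G' n k r t) ≡ N r t (G n k r t)
N-G′≡N-G n k r t t≥1 r+t≤n = cong length (filter-combinations-restrict
  (λ F → r + t ∸ 1 ≤? ∣ F ∩ I ∣) (λ F → ∣ F ∩ I ∣ ≟ r + t ∸ 1) (≤-reflexive ∘ sym)
  (isTriangle? r t) (suc r) (kSubsets n k) triangle⇒exact)
  where
  I = initSeg n (r + t)
  ∣I∣ : ∣ I ∣ ≡ r + t
  ∣I∣ = ∣initSeg∣ r+t≤n
  triangle⇒exact : ∀ Fs → length Fs ≡ suc r → All (λ F → r + t ∸ 1 ≤ ∣ F ∩ I ∣) Fs → IsTriangle r t Fs →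
                   All (λ F → ∣ F ∩ I ∣ ≡ r + t ∸ 1) Fs
  triangle⇒exact Fs len meets (_ , ∣⋂∣<t) = All.tabulate exact
    where
    exact : ∀ {F} → F ∈ Fs → ∣ F ∩ I ∣ ≡ r + t ∸ 1
    exact {F} F∈ with ∣ F ∩ I ∣ ≟ r + t ∸ 1
    ... | yes eq  = eq
    ... | no  neq = contradiction ∣⋂∣<t (≤⇒≯ (+-cancelˡ-≤ r t _ (≤-pred (begin
        suc (r + t)                ≡⟨ cong suc ∣I∣ ⟨
        suc ∣ I ∣                  ≤⟨ ∣⋂∣-lower-bound-strict I Fs (All.map (λ {F} → subst (λ c → c ∸ 1 ≤ ∣ F ∩ I ∣) (sym ∣I∣)) meets) F∈ I⊆F ⟩
        length Fs + ∣ ⋂ Fs ∣       ≡⟨ cong (_+ ∣ ⋂ Fs ∣) len ⟩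
        suc r + ∣ ⋂ Fs ∣           ∎))))
      where
      open ≤-Reasoning
      I⊆F : ∣ I ∣ ≤ ∣ F ∩ I ∣
      I⊆F = begin
        ∣ I ∣                      ≡⟨ ∣I∣ ⟩
        r + t                      ≡⟨ m∸n+n≡m (≤-trans t≥1 (m≤n+m t r)) ⟨
        (r + t ∸ 1) + 1            ≡⟨ +-comm _ 1 ⟩
        suc (r + t ∸ 1)            ≤⟨ ≤∧≢⇒< (All.lookup meets F∈) (neq ∘ sym) ⟩
        ∣ F ∩ I ∣                  ∎

-- Triangles of G built from missing points

allBut : ∀ {c} → Fin c → Subset c
allBut zero    = outside ∷ ⊤
allBut (suc i) = inside ∷ allBut i

allBut-≺ : ∀ {c} {i j : Fin c} → j Fin.< i → allBut i ≺ allBut j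
allBut-≺ {i = suc i} {zero}  _         = in≺out
allBut-≺ {i = suc i} {suc j} (s≤s j<i) = ∷≺∷ (allBut-≺ j<i)

allBut-injective : ∀ {c} {i j : Fin c} → allBut i ≡ allBut j → i ≡ j
allBut-injective {i = zero}  {zero}  _  = refl
allBut-injective {i = suc i} {suc j} eq = cong suc (allBut-injective (∷-injectiveʳᵥ eq))

∣allBut∣ : ∀ {c} (i : Fin c) → ∣ allBut i ∣ ≡ c ∸ 1
∣allBut∣ {suc c}       zero    = ∣⊤∣≡n c
∣allBut∣ {suc (suc c)} (suc i) = cong suc (∣allBut∣ i)

∈allBut : ∀ {c} {i j : Fin c} → i ≢ j → i ∈ₛ allBut j
∈allBut {i = zero}  {zero}  i≢j = ⊥-elim (i≢j refl)
∈allBut {i = zero}  {suc j} _   = here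
∈allBut {i = suc i} {zero}  _   = there ∈⊤
∈allBut {i = suc i} {suc j} i≢j = there (∈allBut (i≢j ∘ cong suc))

∣allBut∩p∣ : ∀ {c} (i : Fin c) (p : Subset c) → i ∈ₛ p → suc ∣ allBut i ∩ p ∣ ≡ ∣ p ∣
∣allBut∩p∣ zero    (inside  ∷ p) _          = cong suc (cong ∣_∣ (∩-identityˡ p))
∣allBut∩p∣ (suc i) (inside  ∷ p) (there i∈) = cong suc (∣allBut∩p∣ i p i∈)
∣allBut∩p∣ (suc i) (outside ∷ p) (there i∈) = ∣allBut∩p∣ i p i∈

∣⋂allBut∣+length≡c : ∀ {c} (is : List (Fin c)) → Unique is → ∣ ⋂ (map allBut is) ∣ + length is ≡ c
∣⋂allBut∣+length≡c {c} []       _          = trans (+-identityʳ _) (∣⊤∣≡n c)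
∣⋂allBut∣+length≡c {c} (i ∷ is) (i∉is ∷ u) = begin
  ∣ allBut i ∩ ⋂ (map allBut is) ∣ + suc (length is)  ≡⟨ +-suc _ (length is) ⟩
  suc ∣ allBut i ∩ ⋂ (map allBut is) ∣ + length is    ≡⟨ cong (_+ length is) (∣allBut∩p∣ i _ (i∈⋂ is i∉is)) ⟩
  ∣ ⋂ (map allBut is) ∣ + length is                   ≡⟨ ∣⋂allBut∣+length≡c is u ⟩
  c                                                   ∎
  where
  open ≡-Reasoning
  i∈⋂ : ∀ js → All (i ≢_) js → i ∈ₛ ⋂ (map allBut js)
  i∈⋂ []       []          = ∈⊤
  i∈⋂ (j ∷ js) (i≢j ∷ i∉js) = x∈p∩q⁺ (∈allBut i≢j , i∈⋂ js i∉js)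

-- Listed in decreasing order, the sets [c] ∖ {x} appear in the order of `allSubsets`, so glued families
-- are sublists of G.
allFinDescending : ∀ c → List (Fin c)
allFinDescending zero    = []
allFinDescending (suc c) = map suc (allFinDescending c) ++ zero ∷ []

length-allFinDescending : ∀ c → length (allFinDescending c) ≡ c
length-allFinDescending zero    = refl
length-allFinDescending (suc c) = begin
  length (map suc (allFinDescending c) ++ zero ∷ []) ≡⟨ length-++ (map suc (allFinDescending c)) ⟩
  length (map suc (allFinDescending c)) + 1          ≡⟨ cong (_+ 1) (trans (length-map Fin.suc (allFinDescending c)) (length-allFinDescending c)) ⟩
  c + 1                                              ≡⟨ +-comm c 1 ⟩
  suc c                                              ∎
  where open ≡-Reasoning

descending⇒Unique : ∀ {c} {is : List (Fin c)} → AllPairs Fin._>_ is → Unique is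
descending⇒Unique = AllPairs.map (λ j<i i≡j → Fin.<-irrefl (sym i≡j) j<i)

allFinDescending-sorted : ∀ c → AllPairs Fin._>_ (allFinDescending c)
allFinDescending-sorted zero    = []
allFinDescending-sorted (suc c) = shift (allFinDescending c) (allFinDescending-sorted c)
  where
  shift : ∀ (is : List (Fin c)) → AllPairs Fin._>_ is → AllPairs Fin._>_ (map suc is ++ zero ∷ [])
  shift []       []           = [] ∷ []
  shift (i ∷ is) (i>is ∷ sorted) = All.++⁺ (All.map⁺ (All.map s≤s i>is)) (s≤s z≤n ∷ []) ∷ shift is sorted

glue : ∀ {c m} → List (Fin c) → List (Subset m) → List (Subset (c + m))
glue = zipWith (λ i o → allBut i ++ᵥ o)

glue-injective : ∀ {c m} (is is′ : List (Fin c)) (os os′ : List (Subset m)) →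
  length is ≡ length os → length is′ ≡ length os′ → glue is os ≡ glue is′ os′ → is ≡ is′ × os ≡ os′
glue-injective is is′ os os′ = zipWith-injective (λ {i} {i′} eq →
  allBut-injective (++-injectiveˡ (allBut i) (allBut i′) eq) , ++-injectiveʳ (allBut i) (allBut i′) eq) is os is′ os′

length-glue : ∀ {c m} (is : List (Fin c)) (os : List (Subset m)) → length is ≡ length os → length (glue is os) ≡ length is
length-glue is os l = trans (length-zipWith _ is os) (trans (cong (length is ⊓_) (sym l)) (⊓-idem (length is)))

⋂-glue : ∀ {c m} (is : List (Fin c)) (os : List (Subset m)) → length is ≡ length os →
         ⋂ (glue is os) ≡ ⋂ (map allBut is) ++ᵥ ⋂ os
⋂-glue {c} {m} []       []       _ = ⊤-++ c m
⋂-glue         (i ∷ is) (o ∷ os) l =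
  trans (cong ((allBut i ++ᵥ o) ∩_) (⋂-glue is os (suc-injective l))) (∩-++ (allBut i) _ o _)

All-glue : ∀ {c m} {P : Pred (Subset (c + m)) 0ℓ} {Os : List (Subset m)} → (∀ i {o} → o ∈ Os → P (allBut i ++ᵥ o)) →
           ∀ is os → All (_∈ Os) os → All P (glue is os)
All-glue h []       _        _           = []
All-glue h (_ ∷ _)  []       _           = []
All-glue h (i ∷ is) (o ∷ os) (o∈ ∷ os∈) = h i o∈ ∷ All-glue h is os os∈

glue-sorted : ∀ {c m} (is : List (Fin c)) (os : List (Subset m)) → AllPairs Fin._>_ is → AllPairs _≺_ (glue is os)
glue-sorted []       _        _            = []
glue-sorted (_ ∷ _)  []       _            = []
glue-sorted (i ∷ is) (o ∷ os) (i>is ∷ sorted) = later is os i>is ∷ glue-sorted is os sorted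
  where
  later : ∀ js qs → All (i Fin.>_) js → All ((allBut i ++ᵥ o) ≺_) (glue js qs)
  later []       _        _            = []
  later (_ ∷ _)  []       _            = []
  later (j ∷ js) (q ∷ qs) (i>j ∷ i>js) = ≺-++ o q (allBut-≺ i>j) ∷ later js qs i>js

tuplesWithEmpty⋂ : ∀ p m s → List (List (Subset m))
tuplesWithEmpty⋂ p m s = filter (λ os → ∣ ⋂ os ∣ ≟ 0) (tuples p (kSubsets m s))

length-tuplesWithEmpty⋂ : ∀ p m s →
  (suc m choose suc s) ^ p ≤ length (tuplesWithEmpty⋂ p (suc m) (suc s)) + suc m * (m choose s) ^ p
length-tuplesWithEmpty⋂ p m s = begin
  (suc m choose suc s) ^ p                ≡⟨ trans (length-tuples p ps) (cong (_^ p) (length-kSubsets (suc m) (suc s))) ⟨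
  length (tuples p ps)                    ≤⟨ union-bound (suc m) (λ os → ∣ ⋂ os ∣ ≟ 0) (λ j → all? (j ∈?_))
                                               (tuples p ps) common-element (λ j → ≤-reflexive (containing j)) ⟩
  length (tuplesWithEmpty⋂ p (suc m) (suc s)) + suc m * (m choose s) ^ p ∎
  where
  open ≤-Reasoning
  ps = kSubsets (suc m) (suc s)
  common-element : ∀ {os} → ∣ ⋂ os ∣ ≢ 0 → Σ (Fin (suc m)) λ j → All (j ∈ₛ_) os
  common-element {os} ∣⋂os∣≢0 = let j , j∈⋂os = ∣p∣≢0⇒Nonempty (⋂ os) ∣⋂os∣≢0 in j , x∈⋂⁻ os j∈⋂os
  containing : ∀ j → length (filter (all? (j ∈?_)) (tuples p ps)) ≡ (m choose s) ^ p
  containing j = trans (length-filter-all-tuples (j ∈?_) p ps) (cong (_^ p) (length-kSubsets-∋ m s j))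

module Construction (r t m s k : ℕ) (t≥1 : 1 ≤ t) (r+t∸1+s≡k : r + t ∸ 1 + s ≡ k) where

  private
    I : Subset (r + t + m)
    I = initSeg (r + t + m) (r + t)

  ∣allBut++o∩I∣ : ∀ i (o : Subset m) → ∣ (allBut i ++ᵥ o) ∩ I ∣ ≡ r + t ∸ 1
  ∣allBut++o∩I∣ i o = begin
    ∣ (allBut i ++ᵥ o) ∩ I ∣                     ≡⟨ cong (λ J → ∣ (allBut i ++ᵥ o) ∩ J ∣) (initSeg-+ (r + t) m) ⟩
    ∣ (allBut i ++ᵥ o) ∩ (⊤ {r + t} ++ᵥ ⊥ {m}) ∣ ≡⟨ cong ∣_∣ (∩-++ (allBut i) ⊤ o ⊥) ⟩
    ∣ (allBut i ∩ ⊤) ++ᵥ (o ∩ ⊥) ∣               ≡⟨ cong₂ (λ u v → ∣ u ++ᵥ v ∣) (∩-identityʳ (allBut i)) (∩-zeroʳ o) ⟩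
    ∣ allBut i ++ᵥ ⊥ {m} ∣                       ≡⟨ ∣p++q∣≡∣p∣+∣q∣ (allBut i) ⊥ ⟩
    ∣ allBut i ∣ + ∣ ⊥ {m} ∣                     ≡⟨ cong₂ _+_ (∣allBut∣ i) (∣⊥∣≡0 m) ⟩
    r + t ∸ 1 + 0                                ≡⟨ +-identityʳ _ ⟩
    r + t ∸ 1                                    ∎
    where open ≡-Reasoning

  record Admissible (is : List (Fin (r + t))) (os : List (Subset m)) : Set where
    field
      length-is  : length is ≡ suc r
      length-os  : length os ≡ suc r
      descending : AllPairs Fin._>_ is
      os-sized   : All (_∈ kSubsets m s) os
      ⋂os≡∅      : ∣ ⋂ os ∣ ≡ 0

    lengths : length is ≡ length os
    lengths = trans length-is (sym length-os)

  configurations : List (List (Fin (r + t)) × List (Subset m))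
  configurations = cartesianProduct (combinations (suc r) (allFinDescending (r + t))) (tuplesWithEmpty⋂ (suc r) m s)

  ∈configurations⇒Admissible : ∀ {is os} → (is , os) ∈ configurations → Admissible is os
  ∈configurations⇒Admissible {is} {os} d∈
    with is∈ , os∈ ← ∈-cartesianProduct⁻ (combinations (suc r) (allFinDescending (r + t))) (tuplesWithEmpty⋂ (suc r) m s) d∈ = record
    { length-is  = proj₁ is-facts
    ; length-os  = proj₁ os-facts
    ; descending = AllPairs-resp-⊇ (proj₂ is-facts) (allFinDescending-sorted (r + t))
    ; os-sized   = proj₂ os-facts
    ; ⋂os≡∅      = proj₂ (∈-filter⁻ (λ os → ∣ ⋂ os ∣ ≟ 0) {xs = tuples (suc r) (kSubsets m s)} os∈)
    }
    where
    is-facts = ∈-combinations⁻ (suc r) (allFinDescending (r + t)) is∈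
    os-facts = ∈-tuples⁻ (suc r) (kSubsets m s) (proj₁ (∈-filter⁻ (λ os → ∣ ⋂ os ∣ ≟ 0) {xs = tuples (suc r) (kSubsets m s)} os∈))

  glue-triangle : ∀ {is os} → Admissible is os →
                  glue is os ∈ filter (isTriangle? r t) (combinations (suc r) (G (r + t + m) k r t))
  glue-triangle {is} {os} adm = ∈-filter⁺ (isTriangle? r t) T∈combinations
    (∣∩s∣≡∣s∣∸1⇒RWiseTIntersecting r t I (∣initSeg∣ (m≤m+n (r + t) m)) T exact , ∣⋂T∣<t)
    where
    open Admissible adm
    T = glue is os
    exact : All (λ F → ∣ F ∩ I ∣ ≡ r + t ∸ 1) T
    exact = All-glue (λ i {o} _ → ∣allBut++o∩I∣ i o) is os os-sized
    sized : All (λ F → ∣ F ∣ ≡ k) T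
    sized = All-glue (λ i {o} o∈ → trans (∣p++q∣≡∣p∣+∣q∣ (allBut i) o)
      (trans (cong₂ _+_ (∣allBut∣ i) (proj₂ (∈-filter⁻ (λ p → ∣ p ∣ ≟ s) {xs = allSubsets m} o∈))) r+t∸1+s≡k)) is os os-sized
    T⊆G : T ⊆ G (r + t + m) k r t
    T⊆G = ⊆-filter⁺ _ (⊆-filter⁺ _ (sorted⇒⊆allSubsets (r + t + m) (glue-sorted is os descending)) sized) exact
    T∈combinations : T ∈ combinations (suc r) (G (r + t + m) k r t)
    T∈combinations = subst (λ p → T ∈ combinations p (G (r + t + m) k r t)) (trans (length-glue is os lengths) length-is)
      (⊆⇒∈-combinations T⊆G)
    ∣⋂T∣<t : ∣ ⋂ T ∣ < t
    ∣⋂T∣<t = +-cancelʳ-≤ r (suc ∣ ⋂ T ∣) t (≤-reflexive (begin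
      suc ∣ ⋂ T ∣ + r                        ≡⟨ cong (λ x → suc ∣ x ∣ + r) (⋂-glue is os lengths) ⟩
      suc ∣ ⋂ (map allBut is) ++ᵥ ⋂ os ∣ + r ≡⟨ cong (λ x → suc x + r) (∣p++q∣≡∣p∣+∣q∣ (⋂ (map allBut is)) (⋂ os)) ⟩
      suc (a + ∣ ⋂ os ∣) + r                 ≡⟨ cong (λ x → suc (a + x) + r) ⋂os≡∅ ⟩
      suc (a + 0) + r                        ≡⟨ cong (λ x → suc x + r) (+-identityʳ a) ⟩
      suc a + r                              ≡⟨ +-suc a r ⟨
      a + suc r                              ≡⟨ cong (a +_) length-is ⟨
      a + length is                          ≡⟨ ∣⋂allBut∣+length≡c is (descending⇒Unique descending) ⟩
      r + t                                  ≡⟨ +-comm r t ⟩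
      t + r                                  ∎))
      where
      open ≡-Reasoning
      a = ∣ ⋂ (map allBut is) ∣

  glue′ : List (Fin (r + t)) × List (Subset m) → List (Subset (r + t + m))
  glue′ (is , os) = glue is os

  glue′-injective : ∀ {d d′} → d ∈ configurations → d′ ∈ configurations → glue′ d ≡ glue′ d′ → d ≡ d′
  glue′-injective {is , os} {is′ , os′} d∈ d′∈ eq =
    let is≡is′ , os≡os′ = glue-injective is is′ os os′
          (Admissible.lengths (∈configurations⇒Admissible d∈)) (Admissible.lengths (∈configurations⇒Admissible d′∈)) eq
    in cong₂ _,_ is≡is′ os≡os′

  count : ((r + t) choose suc r) * length (tuplesWithEmpty⋂ (suc r) m s) ≤ N r t (G (r + t + m) k r t)
  count = begin
    ((r + t) choose suc r) * length good                 ≡⟨ cong (λ x → (x choose suc r) * length good) (length-allFinDescending (r + t)) ⟨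
    (length indices choose suc r) * length good          ≡⟨ cong (_* length good) (length-combinations (suc r) indices) ⟨
    length (combinations (suc r) indices) * length good  ≡⟨ length-cartesianProduct (combinations (suc r) indices) good ⟨
    length configurations                                ≡⟨ length-map glue′ configurations ⟨
    length (map glue′ configurations)                    ≤⟨ Unique⇒length≤ (Unique-map-on glue′ glue′-injective configurations-Unique)
                                                              (All.map⁺ (All.tabulate (glue-triangle ∘ ∈configurations⇒Admissible))) ⟩
    N r t (G (r + t + m) k r t)                          ∎
    where
    open ≤-Reasoning
    indices = allFinDescending (r + t)
    good = tuplesWithEmpty⋂ (suc r) m s
    configurations-Unique : Unique configurations
    configurations-Unique = Unique.cartesianProduct⁺
      (Unique-combinations (suc r) (descending⇒Unique (allFinDescending-sorted (r + t))))
      (Unique.filter⁺ _ (Unique-tuples (suc r) (Unique-kSubsets m s)))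

^-distribʳ-* : ∀ a b p → (a * b) ^ p ≡ a ^ p * b ^ p
^-distribʳ-* a b zero    = refl
^-distribʳ-* a b (suc p) = trans (cong (a * b *_) (^-distribʳ-* a b p)) (interchange a b (a ^ p) (b ^ p))
  where
  interchange : ∀ a b x y → a * b * (x * y) ≡ a * x * (b * y)
  interchange = solve-∀

8*n≤[n+2]² : ∀ n → 8 * n ≤ (n + 2) * (n + 2)
8*n≤[n+2]² 0             = z≤n
8*n≤[n+2]² 1             = m≤m+n 8 1
8*n≤[n+2]² (suc (suc n)) = subst (8 * suc (suc n) ≤_) (square n) (m≤m+n _ (n * n))
  where
  square : ∀ n → 8 * (2 + n) + n * n ≡ (2 + n + 2) * (2 + n + 2)
  square = solve-∀

n≤n^[1+p] : ∀ n p .{{_ : NonZero n}} → n ≤ n ^ suc p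
n≤n^[1+p] n p = m≤m*n n (n ^ p) {{m^n≢0 n p}}

2*k³≤m : ∀ k c m .{{_ : NonZero k}} → 3 ≤ k → c ≤ k → k ^ 4 ≤ c + m → 2 * k ^ 3 ≤ m
2*k³≤m k c m 3≤k c≤k k⁴≤c+m = +-cancelʳ-≤ c (2 * k ^ 3) m (begin
  2 * k ^ 3 + c      ≤⟨ +-monoʳ-≤ (2 * k ^ 3) (≤-trans c≤k (n≤n^[1+p] k 2)) ⟩
  2 * k ^ 3 + k ^ 3  ≡⟨ +-comm (2 * k ^ 3) (k ^ 3) ⟩
  3 * k ^ 3          ≤⟨ *-monoˡ-≤ (k ^ 3) 3≤k ⟩
  k ^ 4              ≤⟨ k⁴≤c+m ⟩
  c + m              ≡⟨ +-comm c m ⟩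
  m + c              ∎)
  where open ≤-Reasoning

1000*s³≤m² : ∀ s k m → s + 2 ≤ k → 2 * k ^ 3 ≤ m → 1000 * s ^ 3 ≤ m ^ 2
1000*s³≤m² s k m s+2≤k 2k³≤m = begin
  1000 * s ^ 3     ≤⟨ *-monoˡ-≤ (s ^ 3) (m≤m+n 1000 1048) ⟩
  2048 * s ^ 3     ≡⟨ cube s ⟩
  4 * (8 * s) ^ 3  ≤⟨ *-monoʳ-≤ 4 (^-monoˡ-≤ 3 (≤-trans (8*n≤[n+2]² s) (*-mono-≤ s+2≤k s+2≤k))) ⟩
  4 * (k * k) ^ 3  ≡⟨ square k ⟩
  (2 * k ^ 3) ^ 2  ≤⟨ ^-monoˡ-≤ 2 2k³≤m ⟩
  m ^ 2            ∎
  where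
  open ≤-Reasoning
  -- `solve-∀` does not normalise `_^_`, so the powers are unfolded.
  cube : ∀ x → 2048 * (x * (x * (x * 1))) ≡ 4 * (8 * x * (8 * x * (8 * x * 1)))
  cube = solve-∀
  square : ∀ x → 4 * (x * x * (x * x * (x * x * 1))) ≡ 2 * (x * (x * (x * 1))) * (2 * (x * (x * (x * 1))) * 1)
  square = solve-∀

a*s^[1+r]≤m^r : ∀ a s m r → 2 ≤ r → a * s ^ 3 ≤ m ^ 2 → s ≤ m → a * s ^ suc r ≤ m ^ r
a*s^[1+r]≤m^r a s m 1                   (s≤s ()) _ _
a*s^[1+r]≤m^r a s m 2                   _        h _   = h
a*s^[1+r]≤m^r a s m (suc (suc (suc r))) _        h s≤m = begin
  a * s ^ (4 + r)        ≡⟨ rotate a s (s ^ (3 + r)) ⟩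
  s * (a * s ^ (3 + r))  ≤⟨ *-mono-≤ s≤m (a*s^[1+r]≤m^r a s m (suc (suc r)) (s≤s (s≤s z≤n)) h s≤m) ⟩
  m * m ^ (2 + r)        ∎
  where
  open ≤-Reasoning
  rotate : ∀ x y z → x * (y * z) ≡ y * (x * z)
  rotate = solve-∀

a*[c*b]≤[1+a]*n : ∀ a c b g x n → b ≤ g + x → suc a * x ≤ b → c * g ≤ n → a * (c * b) ≤ suc a * n
a*[c*b]≤[1+a]*n a c b g x n b≤g+x [1+a]x≤b cg≤n = +-cancelʳ-≤ (c * b) (a * (c * b)) (suc a * n) (begin
  a * (c * b) + c * b                ≡⟨ +-comm (a * (c * b)) (c * b) ⟩
  suc a * (c * b)                    ≤⟨ *-monoʳ-≤ (suc a) (*-monoʳ-≤ c b≤g+x) ⟩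
  suc a * (c * (g + x))              ≡⟨ expand a c g x ⟩
  suc a * (c * g) + c * (suc a * x)  ≤⟨ +-mono-≤ (*-monoʳ-≤ (suc a) cg≤n) (*-monoʳ-≤ c [1+a]x≤b) ⟩
  suc a * n + c * b                  ∎)
  where
  open ≤-Reasoning
  expand : ∀ a c g x → suc a * (c * (g + x)) ≡ suc a * (c * g) + c * (suc a * x)
  expand = solve-∀

a*[1+m]*[m-choose-s]^[1+r]≤[1+m-choose-1+s]^[1+r] : ∀ a r m s → a * suc s ^ suc r ≤ suc m ^ r →
  a * (suc m * (m choose s) ^ suc r) ≤ (suc m choose suc s) ^ suc r
a*[1+m]*[m-choose-s]^[1+r]≤[1+m-choose-1+s]^[1+r] a r m s h = *-cancelˡ-≤ (m₁ ^ r) {{m^n≢0 m₁ r}} (begin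
  m₁ ^ r * (a * (m₁ * d ^ p)) ≡⟨ regroup (m₁ ^ r) (d ^ p) m₁ a ⟩
  a * (m₁ ^ p * d ^ p)        ≡⟨ cong (a *_) (^-distribʳ-* m₁ d p) ⟨
  a * (m₁ * d) ^ p            ≡⟨ cong (λ x → a * x ^ p) (suc-*-choose m s) ⟩
  a * (s₁ * b) ^ p            ≡⟨ cong (a *_) (^-distribʳ-* s₁ b p) ⟩
  a * (s₁ ^ p * b ^ p)        ≡⟨ *-assoc a (s₁ ^ p) (b ^ p) ⟨
  a * s₁ ^ p * b ^ p          ≤⟨ *-monoˡ-≤ (b ^ p) h ⟩
  m₁ ^ r * b ^ p              ∎)
  where
  open ≤-Reasoning
  m₁ = suc m
  s₁ = suc s
  p = suc r
  d = m choose s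
  b = suc m choose suc s
  regroup : ∀ x y z w → x * (w * (z * y)) ≡ w * (z * x * y)
  regroup = solve-∀

N-G-lower-bound : ∀ r t m s k → 2 ≤ r → 1 ≤ t → r + t ∸ 1 + suc s ≡ k → 1000 * suc s ^ 3 ≤ m ^ 2 → suc s ≤ m →
  999 * (((r + t) choose suc r) * (m choose suc s) ^ suc r) ≤ 1000 * N r t (G (r + t + m) k r t)
N-G-lower-bound r t (suc m) s k 2≤r 1≤t size 1000s³≤m² s<m =
  a*[c*b]≤[1+a]*n 999 ((r + t) choose suc r) ((suc m choose suc s) ^ suc r)
    (length (tuplesWithEmpty⋂ (suc r) (suc m) (suc s))) (suc m * (m choose s) ^ suc r) (N r t (G (r + t + suc m) k r t))
    (length-tuplesWithEmpty⋂ (suc r) m s)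
    (a*[1+m]*[m-choose-s]^[1+r]≤[1+m-choose-1+s]^[1+r] 1000 r m s (a*s^[1+r]≤m^r 1000 (suc s) (suc m) r 2≤r 1000s³≤m² s<m))
    (Construction.count r t (suc m) (suc s) k 1≤t size)

N-G-lower-bound-k⁴≤n : ∀ r t m s k → 2 ≤ r → 1 ≤ t → s + (r + t) ≡ k → k ^ 4 ≤ r + t + m →
  999 * (((r + t) C suc r) * (m C (s + 1)) ^ suc r) ≤ 1000 * N r t (G (r + t + m) k r t)
N-G-lower-bound-k⁴≤n r t m s k 2≤r 1≤t s+r+t≡k k⁴≤n =
  ≤-trans (≤-reflexive (cong (999 *_) (sym binomials)))
          (N-G-lower-bound r t m s k 2≤r 1≤t size (1000*s³≤m² (suc s) k m s+3≤k 2k³≤m) s<m)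
  where
  -- Typed with `suc s` on the left, so that no conversion check has to unfold `_C_`.
  suc-s≡s+1 : suc s ≡ s + 1
  suc-s≡s+1 = +-comm 1 s
  binomials : ((r + t) choose suc r) * (m choose suc s) ^ suc r ≡ ((r + t) C suc r) * (m C (s + 1)) ^ suc r
  binomials = cong₂ (λ a b → a * b ^ suc r) (choose≡C (r + t) (suc r)) (trans (choose≡C m (suc s)) (cong (m C_) suc-s≡s+1))
  3≤r+t : 3 ≤ r + t
  3≤r+t = +-mono-≤ 2≤r 1≤t
  r+t≤k : r + t ≤ k
  r+t≤k = ≤-trans (m≤n+m (r + t) s) (≤-reflexive s+r+t≡k)
  3≤k : 3 ≤ k
  3≤k = ≤-trans 3≤r+t r+t≤k
  instance
    r+t≢0 : NonZero (r + t)
    r+t≢0 = >-nonZero (≤-trans (s≤s z≤n) 3≤r+t)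
    k≢0 : NonZero k
    k≢0 = >-nonZero (≤-trans (s≤s z≤n) 3≤k)
  size : r + t ∸ 1 + suc s ≡ k
  size = begin
    r + t ∸ 1 + suc s    ≡⟨ +-suc (r + t ∸ 1) s ⟩
    suc (r + t ∸ 1) + s  ≡⟨ cong (_+ s) (suc-pred (r + t)) ⟩
    r + t + s            ≡⟨ +-comm (r + t) s ⟩
    s + (r + t)          ≡⟨ s+r+t≡k ⟩
    k                    ∎
    where open ≡-Reasoning
  s+3≤k : suc s + 2 ≤ k
  s+3≤k = ≤-trans (≤-reflexive (sym (+-suc s 2))) (≤-trans (+-monoʳ-≤ s 3≤r+t) (≤-reflexive s+r+t≡k))
  2k³≤m : 2 * k ^ 3 ≤ m
  2k³≤m = 2*k³≤m k (r + t) m 3≤k r+t≤k k⁴≤n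
  s<m : suc s ≤ m
  s<m = begin
    suc s        ≤⟨ m≤m+n (suc s) 2 ⟩
    suc s + 2    ≤⟨ s+3≤k ⟩
    k            ≤⟨ n≤n^[1+p] k 2 ⟩
    k ^ 3        ≤⟨ m≤n*m (k ^ 3) 2 ⟩
    2 * k ^ 3    ≤⟨ 2k³≤m ⟩
    m            ∎
    where open ≤-Reasoning

lemma2p1 : (n k r t : ℕ) → 2 ≤ r → 1 ≤ t → r + t ≤ k → k ^ 4 ≤ n →
    (N r t (G' n k r t) ≡ N r t (G n k r t))
    × (999 * (((r + t) C (suc r)) * (((n ∸ r ∸ t) C (k ∸ r ∸ t + 1)) ^ (suc r)))
       ≤ 1000 * N r t (G n k r t))
lemma2p1 n k r t 2≤r 1≤t r+t≤k k⁴≤n =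
  N-G′≡N-G n k r t 1≤t r+t≤n ,
  ≤-trans (N-G-lower-bound-k⁴≤n r t (n ∸ r ∸ t) (k ∸ r ∸ t) k 2≤r 1≤t
             (trans (cong (_+ (r + t)) (∸-+-assoc k r t)) (m∸n+n≡m r+t≤k))
             (subst (k ^ 4 ≤_) (sym r+t+[n∸r∸t]≡n) k⁴≤n))
          (≤-reflexive (cong (λ n′ → 1000 * N r t (G n′ k r t)) r+t+[n∸r∸t]≡n))
  where
  r+t≤n : r + t ≤ n
  r+t≤n = ≤-trans r+t≤k (≤-trans (n≤n^[1+p] k 3 {{>-nonZero (≤-trans (s≤s z≤n) (≤-trans (+-mono-≤ 2≤r 1≤t) r+t≤k))}}) k⁴≤n)
  r+t+[n∸r∸t]≡n : r + t + (n ∸ r ∸ t) ≡ n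
  r+t+[n∸r∸t]≡n = trans (cong (r + t +_) (∸-+-assoc n r t)) (m+[n∸m]≡n r+t≤n)
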